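{- Let $(\mathcal{O},g,f)$ be an oriented matroid program and let $X,Y$ be comodular cocircuits of $\mathcal{O}$ with $X_f=Y_f=X_g=Y_g\neq0$. Then $X\to_{g,f}Y$ if and only if $X\leftarrow_{f,g}Y$.
   Context: Cocircuits are the minimal nonzero covectors of the oriented matroid $\mathcal{O}$ on $E$ of rank $r$; $z(X)=\{e:X_e=0\}$, $\mathrm{sep}(X,Y)=\{e:X_e=-Y_e\ne0\}$. Cocircuits $X\ne\pm Y$ are comodular if $z(X\circ Y)$ is a flat of rank $r-2$; then for $e\in\mathrm{sep}(X,Y)$ cocircuit elimination of $e$ between $X$ and $Y$ gives the unique cocircuit $Z$ with $Z_e=0$ and $\mathrm{supp}(Z)\subseteq\mathrm{supp}(X\circ Y)\setminus\{e\}$. For distinct $a,b\in E$ and comodular cocircuits $X,Y$ with $X_a=Y_a\ne0$, let $Z$ be the elimination of $a$ between $-X$ and $Y$; write $X\to_{a,b}Y$ if $Z_b=+$, $X\leftarrow_{a,b}Y$ if $Z_b=-$, $X\leftrightarrow_{a,b}Y$ if $Z_b=0$. An oriented matroid program $(\mathcal{O},g,f)$ consists of distinct $g,f\in E$, $g$ not a loop, $f$ not a coloop. -}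

module Defs where

open import Data.Nat using (ℕ; _≤_; _<_; _∸_)
open import Data.Bool using (Bool; true; false)
open import Data.Fin using (Fin)
open import Data.Fin.Subset using (Subset; _∈_; _∉_; _⊆_; _⊂_; _∪_; ⁅_⁆; ∣_∣)
import Data.Fin.Subset as Sub
open import Data.Vec using (Vec; lookup; map; replicate; tabulate; zipWith)
open import Data.Product using (Σ; ∃; _×_)
open import Data.Sum using (_⊎_)
open import Relation.Nullary using (¬_)
open import Relation.Binary.PropositionalEquality using (_≡_; _≢_)

data Sign : Set where
  ⊖ ⊙ ⊕ : Sign

neg : Sign → Sign
neg ⊖ = ⊕
neg ⊙ = ⊙
neg ⊕ = ⊖

SignVec : ℕ → Set
SignVec n = Vec Sign n

negV : ∀ {n} → SignVec n → SignVec n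
negV = map neg

zeroV : ∀ {n} → SignVec n
zeroV = replicate _ ⊙

composeS : Sign → Sign → Sign
composeS ⊙ t = t
composeS s t = s

_∘ₛ_ : ∀ {n} → SignVec n → SignVec n → SignVec n
_∘ₛ_ = zipWith composeS

isZero : Sign → Bool
isZero ⊙ = true
isZero _ = false

zset : ∀ {n} → SignVec n → Subset n
zset X = tabulate (λ e → isZero (lookup X e))

_⊑ₛ_ : ∀ {n} → SignVec n → SignVec n → Set
X ⊑ₛ Y = ∀ i → lookup X i ≢ ⊙ → lookup Y i ≢ ⊙

ElimSigns : ∀ {n} → SignVec n → SignVec n → SignVec n → Set
ElimSigns X Y Z = ∀ i →
  (lookup Z i ≡ ⊕ → lookup X i ≡ ⊕ ⊎ lookup Y i ≡ ⊕) ×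
  (lookup Z i ≡ ⊖ → lookup X i ≡ ⊖ ⊎ lookup Y i ≡ ⊖)

-- Oriented matroids on Fin n, given by their set of cocircuits
-- (cocircuit axioms (C0)-(C3), Björner et al.)

record OrientedMatroid (n : ℕ) : Set₁ where
  field
    Cocircuit : SignVec n → Set
    C0 : ¬ Cocircuit zeroV
    C1 : ∀ {X} → Cocircuit X → Cocircuit (negV X)
    C2 : ∀ {X Y} → Cocircuit X → Cocircuit Y → X ⊑ₛ Y → X ≡ Y ⊎ X ≡ negV Y
    C3 : ∀ {X Y} → Cocircuit X → Cocircuit Y → X ≢ negV Y →
         ∀ e → lookup X e ≡ ⊕ → lookup Y e ≡ ⊖ →
         ∃ λ Z → Cocircuit Z × lookup Z e ≡ ⊙ × ElimSigns X Y Z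

data Dir : Set where
  to from both : Dir

dirSign : Dir → Sign
dirSign to = ⊕
dirSign from = ⊖
dirSign both = ⊙

module _ {n : ℕ} (O : OrientedMatroid n) where
  open OrientedMatroid O

  -- The underlying matroid (its cocircuits are the supports of the
  -- signed cocircuits)

  Spanning : Subset n → Set
  Spanning S = ∀ X → Cocircuit X → ∃ λ e → e ∈ S × lookup X e ≢ ⊙

  IsBasis : Subset n → Set
  IsBasis B = Spanning B × (∀ S → S ⊂ B → ¬ Spanning S)

  Independent : Subset n → Set
  Independent I = ∃ λ B → IsBasis B × I ⊆ B

  HasRank : Subset n → ℕ → Set
  HasRank A k =
    (∃ λ I → I ⊆ A × Independent I × ∣ I ∣ ≡ k) ×
    (∀ I → I ⊆ A → Independent I → ∣ I ∣ ≤ k)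

  IsFlat : Subset n → Set
  IsFlat F = ∀ e → e ∉ F → ∀ k k' → HasRank F k → HasRank (F ∪ ⁅ e ⁆) k' → k < k'

  IsLoop : Fin n → Set
  IsLoop e = ∀ B → IsBasis B → e ∉ B

  IsColoop : Fin n → Set
  IsColoop e = ∀ B → IsBasis B → e ∈ B

  Comodular : SignVec n → SignVec n → Set
  Comodular X Y =
    X ≢ Y × X ≢ negV Y × IsFlat (zset (X ∘ₛ Y)) ×
    (∀ r → HasRank Sub.⊤ r → HasRank (zset (X ∘ₛ Y)) (r ∸ 2))

  IsElimination : Fin n → SignVec n → SignVec n → SignVec n → Set
  IsElimination e X Y Z = Cocircuit Z × lookup Z e ≡ ⊙ × ElimSigns X Y Z

  Arrow : Fin n → Fin n → SignVec n → SignVec n → Dir → Set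
  Arrow a b X Y d =
    Cocircuit X × Cocircuit Y × Comodular X Y ×
    lookup X a ≡ lookup Y a × lookup X a ≢ ⊙ ×
    (∃ λ Z → IsElimination a (negV X) Y Z × lookup Z b ≡ dirSign d)

{-# OPTIONS --safe #-}
-- Let F = z(X ∘ Y) and s the common sign of X and Y at f and g. As F is a flat of corank two,
-- F ∪ {e} is a hyperplane for every e ∉ F, so cocircuits vanishing on it all have the same zero
-- set. Given the elimination Z of g between -X and Y with Z_f = +, eliminate f between Z and
-- whichever of -X, Y is negative at f and g: the result W eliminates f between -X and Y and has
-- W_g ∈ {0, -}, and W_g = 0 is impossible because Z and W both vanish on F ∪ {g} while
-- Z_f ≠ 0 = W_f. The converse is the same argument with f, g and the signs exchanged.
-- Bases and the rank of O are only obtained under double negation, which suffices because they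
-- are used only to derive a contradiction.
module Submission where

open import Defs
open import Data.Nat using (ℕ; zero; suc; _+_; _≤_; _<_; _∸_; z≤n; s≤s; s≤s⁻¹)
open import Data.Nat.Properties using (≤-refl; ≤-trans; ∸-monoˡ-≤; <-≤-trans; <-irrefl; ≤∧≢⇒<; module ≤-Reasoning)
open import Data.Fin using (Fin; zero; suc)
open import Data.Fin.Subset using (Subset; _∈_; _∉_; _⊆_; _⊂_; _∪_; ⁅_⁆; ∣_∣; ⊤)
open import Data.Fin.Subset.Properties using (∈⊤; x∈⁅x⁆; x∈⁅y⁆⇒x≡y; p⊆p∪q; x∈p∪q⁻; x∈p∪q⁺; p⊆q⇒∣p∣≤∣q∣; p⊂q⇒∣p∣<∣q∣; ∣p∣≤n)
open import Data.Vec using ([]; _∷_; lookup)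
open import Data.Vec.Properties using (lookup-map; lookup-zipWith; lookup∘tabulate; []=⇒lookup)
open import Data.Product using (∃; ∃₂; _×_; _,_; proj₁; proj₂)
open import Data.Sum using (_⊎_; inj₁; inj₂; [_,_])
import Data.Sum as Sum
open import Data.Empty using (⊥-elim)
open import Function using (_∘_)
open import Relation.Nullary using (¬_; Dec; yes; no)
open import Relation.Nullary.Decidable using (¬¬-excluded-middle)
open import Relation.Binary.PropositionalEquality using (_≡_; _≢_; refl; sym; trans; cong; cong₂; subst; subst₂)
open import Function.Bundles using (_⇔_; mk⇔)

private
  variable
    n r : ℕ
    s t u : Sign
    P Q U V W X Y Z : SignVec n
    A B F J : Subset n
    a b e h x : Fin n

neg-involutive : ∀ s → neg (neg s) ≡ s
neg-involutive ⊖ = refl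
neg-involutive ⊙ = refl
neg-involutive ⊕ = refl

neg-injective : neg s ≡ neg t → s ≡ t
neg-injective {s} {t} eq = trans (sym (neg-involutive s)) (trans (cong neg eq) (neg-involutive t))

_≟⊙ : (s : Sign) → Dec (s ≡ ⊙)
⊖ ≟⊙ = no λ ()
⊙ ≟⊙ = yes refl
⊕ ≟⊙ = no λ ()

opposite-or-equal : s ≢ ⊙ → t ≢ ⊙ → t ≡ neg s ⊎ t ≡ s
opposite-or-equal {⊖} {⊖} _ _ = inj₂ refl
opposite-or-equal {⊖} {⊕} _ _ = inj₁ refl
opposite-or-equal {⊕} {⊖} _ _ = inj₁ refl
opposite-or-equal {⊕} {⊕} _ _ = inj₂ refl
opposite-or-equal {⊙} s≢⊙ _ = ⊥-elim (s≢⊙ refl)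
opposite-or-equal {t = ⊙} _ t≢⊙ = ⊥-elim (t≢⊙ refl)

SignCovered : Sign → Sign → Sign → Set
SignCovered s t u = (u ≡ ⊕ → s ≡ ⊕ ⊎ t ≡ ⊕) × (u ≡ ⊖ → s ≡ ⊖ ⊎ t ≡ ⊖)

SignCovered-neg : SignCovered (neg s) (neg t) u → SignCovered s t (neg u)
SignCovered-neg {u = ⊖} (_ , m) = (λ _ → Sum.map neg-injective neg-injective (m refl)) , λ ()
SignCovered-neg {u = ⊙} _ = (λ ()) , (λ ())
SignCovered-neg {u = ⊕} (p , _) = (λ ()) , λ _ → Sum.map neg-injective neg-injective (p refl)

SignCovered-⊙ˡ : SignCovered s t u → s ≡ ⊙ → u ≡ ⊙ ⊎ u ≡ t
SignCovered-⊙ˡ {u = ⊙} _ _ = inj₁ refl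
SignCovered-⊙ˡ {u = ⊕} (p , _) refl with p refl
... | inj₂ t≡⊕ = inj₂ (sym t≡⊕)
SignCovered-⊙ˡ {u = ⊖} (_ , m) refl with m refl
... | inj₂ t≡⊖ = inj₂ (sym t≡⊖)

lookup-negV : ∀ (X : SignVec n) i → lookup (negV X) i ≡ neg (lookup X i)
lookup-negV X i = lookup-map i neg X

negV-involutive : ∀ (X : SignVec n) → negV (negV X) ≡ X
negV-involutive [] = refl
negV-involutive (s ∷ X) = cong₂ _∷_ (neg-involutive s) (negV-involutive X)

negV-injective : negV X ≡ negV Y → X ≡ Y
negV-injective {X = X} {Y} eq = trans (sym (negV-involutive X)) (trans (cong negV eq) (negV-involutive Y))

nonzero-entry : ∀ (X : SignVec n) → X ≢ zeroV → ∃ λ e → lookup X e ≢ ⊙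
nonzero-entry [] X≢0 = ⊥-elim (X≢0 refl)
nonzero-entry (⊖ ∷ X) _ = zero , λ ()
nonzero-entry (⊕ ∷ X) _ = zero , λ ()
nonzero-entry (⊙ ∷ X) X≢0 with nonzero-entry X (X≢0 ∘ cong (⊙ ∷_))
... | e , Xe≢⊙ = suc e , Xe≢⊙

≢negV-at : ∀ i → lookup P i ≡ ⊙ → lookup Q i ≢ ⊙ → P ≢ negV Q
≢negV-at {P = P} {Q} i Pi≡⊙ Qi≢⊙ P≡-Q =
  Qi≢⊙ (neg-injective (trans (sym (lookup-negV Q i)) (trans (cong (λ v → lookup v i) (sym P≡-Q)) Pi≡⊙)))

lookup-negV-≢⊙ : ∀ i → lookup P i ≢ ⊙ → lookup (negV P) i ≢ ⊙
lookup-negV-≢⊙ {P = P} i Pi≢⊙ eq = Pi≢⊙ (neg-injective (trans (sym (lookup-negV P i)) eq))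

VanishesOn : SignVec n → Subset n → Set
VanishesOn P A = ∀ {e} → e ∈ A → lookup P e ≡ ⊙

VanishesOn-negV : VanishesOn P A → VanishesOn (negV P) A
VanishesOn-negV {P = P} P₀ {e} e∈A = trans (lookup-negV P e) (cong neg (P₀ e∈A))

∈zset⇒⊙ : e ∈ zset X → lookup X e ≡ ⊙
∈zset⇒⊙ {e = e} {X} e∈ with lookup X e | trans (sym (lookup∘tabulate (isZero ∘ lookup X) e)) ([]=⇒lookup e∈)
... | ⊙ | _ = refl

∘ₛ-⊙ : ∀ (X Y : SignVec n) e → lookup (X ∘ₛ Y) e ≡ ⊙ → lookup X e ≡ ⊙ × lookup Y e ≡ ⊙
∘ₛ-⊙ X Y e eq with lookup X e | trans (sym (lookup-zipWith composeS e X Y)) eq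
... | ⊙ | Ye≡⊙ = refl , Ye≡⊙

zset-∘ₛ-vanishesˡ : VanishesOn X (zset (X ∘ₛ Y))
zset-∘ₛ-vanishesˡ {X = X} {Y} {e} e∈ = proj₁ (∘ₛ-⊙ X Y e (∈zset⇒⊙ {X = X ∘ₛ Y} e∈))

zset-∘ₛ-vanishesʳ : VanishesOn Y (zset (X ∘ₛ Y))
zset-∘ₛ-vanishesʳ {Y = Y} {X} {e} e∈ = proj₂ (∘ₛ-⊙ X Y e (∈zset⇒⊙ {X = X ∘ₛ Y} e∈))

ElimSigns-left : ElimSigns P Q P
ElimSigns-left i = inj₁ , inj₁

ElimSigns-right : ElimSigns P Q Q
ElimSigns-right i = inj₂ , inj₂

ElimSigns-trans : ElimSigns P Q Z → ElimSigns P Q U → ElimSigns Z U W → ElimSigns P Q W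
ElimSigns-trans Z≼ U≼ W≼ i =
  [ proj₁ (Z≼ i) , proj₁ (U≼ i) ] ∘ proj₁ (W≼ i) , [ proj₂ (Z≼ i) , proj₂ (U≼ i) ] ∘ proj₂ (W≼ i)

ElimSigns-negV : ElimSigns (negV P) (negV Q) Z → ElimSigns P Q (negV Z)
ElimSigns-negV {P = P} {Q} {Z} Z≼ i rewrite lookup-negV Z i =
  SignCovered-neg (subst₂ (λ s t → SignCovered s t (lookup Z i)) (lookup-negV P i) (lookup-negV Q i) (Z≼ i))

ElimSigns-⊙ˡ : ElimSigns P Q Z → ∀ i → lookup P i ≡ ⊙ → lookup Z i ≡ ⊙ ⊎ lookup Z i ≡ lookup Q i
ElimSigns-⊙ˡ Z≼ i = SignCovered-⊙ˡ (Z≼ i)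

ElimSigns-vanishes : ElimSigns P Q Z → VanishesOn P A → VanishesOn Q A → VanishesOn Z A
ElimSigns-vanishes {P = P} {Q} {Z} Z≼ P₀ Q₀ {e} e∈A with ElimSigns-⊙ˡ {P = P} {Q} {Z} Z≼ e (P₀ e∈A)
... | inj₁ Ze≡⊙ = Ze≡⊙
... | inj₂ Ze≡Qe = trans Ze≡Qe (Q₀ e∈A)

¬¬-minimal : (R : Subset n → Set) → R A → ¬ ¬ ∃ λ M → R M × (∀ S → S ⊂ M → ¬ R S)
¬¬-minimal {A = A} R = descend (suc ∣ A ∣) A (s≤s ≤-refl)
  where
  descend : ∀ k S → ∣ S ∣ < k → R S → ¬ ¬ ∃ λ M → R M × (∀ S → S ⊂ M → ¬ R S)
  descend zero S () RS
  descend (suc k) S ∣S∣<k RS ¬min = ¬¬-excluded-middle {A = ∃ λ S' → S' ⊂ S × R S'} λ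
    { (yes (S' , S'⊂S , RS')) → descend k S' (<-≤-trans (p⊂q⇒∣p∣<∣q∣ S'⊂S) (s≤s⁻¹ ∣S∣<k)) RS' ¬min
    ; (no ¬smaller) → ¬min (S , RS , λ S' S'⊂S RS' → ¬smaller (S' , S'⊂S , RS')) }

¬¬-maximum : (R : ℕ → Set) {k : ℕ} → R k → ∀ bound → (∀ m → R m → m ≤ bound) →
  ¬ ¬ ∃ λ m → R m × (∀ m' → R m' → m' ≤ m)
¬¬-maximum R Rk zero bounded ¬max = ¬max (_ , Rk , λ m Rm → ≤-trans (bounded m Rm) z≤n)
¬¬-maximum R Rk (suc b) bounded ¬max = ¬¬-excluded-middle {A = R (suc b)} λ
  { (yes Rb) → ¬max (suc b , Rb , bounded)
  ; (no ¬Rb) → ¬¬-maximum R Rk b (λ m Rm → s≤s⁻¹ (≤∧≢⇒< (bounded m Rm) λ { refl → ¬Rb Rm })) ¬max }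

∣p∣<∣p∪⁅x⁆∣ : x ∉ A → ∣ A ∣ < ∣ A ∪ ⁅ x ⁆ ∣
∣p∣<∣p∪⁅x⁆∣ {x = x} {A} x∉A = p⊂q⇒∣p∣<∣q∣ (p⊆p∪q ⁅ x ⁆ , x , x∈p∪q⁺ (inj₂ (x∈⁅x⁆ x)) , x∉A)

p∪⁅x⁆⊆q : A ⊆ B → x ∈ B → A ∪ ⁅ x ⁆ ⊆ B
p∪⁅x⁆⊆q {A = A} {B} {x} A⊆B x∈B y∈ with x∈p∪q⁻ A ⁅ x ⁆ y∈
... | inj₁ y∈A = A⊆B y∈A
... | inj₂ y∈⁅x⁆ = subst (_∈ B) (sym (x∈⁅y⁆⇒x≡y x y∈⁅x⁆)) x∈B

two-more-elements : ∀ {b₁ b₂ : Fin n} → J ⊆ B → b₁ ≢ b₂ → b₁ ∈ B → b₂ ∈ B → b₁ ∉ J → b₂ ∉ J →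
  2 + ∣ J ∣ ≤ ∣ B ∣
two-more-elements {J = J} {B} {b₁} {b₂} J⊆B b₁≢b₂ b₁∈B b₂∈B b₁∉J b₂∉J = begin-strict
  suc ∣ J ∣                   ≤⟨ ∣p∣<∣p∪⁅x⁆∣ b₁∉J ⟩
  ∣ J ∪ ⁅ b₁ ⁆ ∣              <⟨ ∣p∣<∣p∪⁅x⁆∣ b₂∉J∪b₁ ⟩
  ∣ (J ∪ ⁅ b₁ ⁆) ∪ ⁅ b₂ ⁆ ∣  ≤⟨ p⊆q⇒∣p∣≤∣q∣ (p∪⁅x⁆⊆q (p∪⁅x⁆⊆q J⊆B b₁∈B) b₂∈B) ⟩
  ∣ B ∣                       ∎
  where
  open ≤-Reasoning
  b₂∉J∪b₁ : b₂ ∉ J ∪ ⁅ b₁ ⁆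
  b₂∉J∪b₁ b₂∈ with x∈p∪q⁻ J ⁅ b₁ ⁆ b₂∈
  ... | inj₁ b₂∈J = b₂∉J b₂∈J
  ... | inj₂ b₂∈⁅b₁⁆ = b₁≢b₂ (sym (x∈⁅y⁆⇒x≡y b₁ b₂∈⁅b₁⁆))

vanishes-on-extension : ElimSigns (negV X) Y V → lookup V h ≡ ⊙ → VanishesOn V (zset (X ∘ₛ Y) ∪ ⁅ h ⁆)
vanishes-on-extension {X = X} {Y} {V} {h} V≼ Vh≡⊙ e∈ with x∈p∪q⁻ (zset (X ∘ₛ Y)) ⁅ h ⁆ e∈
... | inj₁ e∈F = ElimSigns-vanishes {P = negV X} {Y} {V} V≼
                   (VanishesOn-negV {P = X} (zset-∘ₛ-vanishesˡ {X = X} {Y})) (zset-∘ₛ-vanishesʳ {Y = Y} {X}) e∈F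
... | inj₂ e∈⁅h⁆ = subst (λ i → lookup V i ≡ ⊙) (sym (x∈⁅y⁆⇒x≡y h e∈⁅h⁆)) Vh≡⊙

module _ (O : OrientedMatroid n) where
  open OrientedMatroid O

  eliminate : Cocircuit P → Cocircuit Q → P ≢ negV Q → lookup P e ≢ ⊙ → lookup Q e ≡ neg (lookup P e) →
    ∃ λ Z → Cocircuit Z × lookup Z e ≡ ⊙ × ElimSigns P Q Z
  eliminate {P = P} {Q} {e} cP cQ P≢-Q Pe≢⊙ Qe with lookup P e in Pe
  ... | ⊙ = ⊥-elim (Pe≢⊙ refl)
  ... | ⊕ = C3 cP cQ P≢-Q e Pe Qe
  ... | ⊖ with C3 (C1 cP) (C1 cQ) (P≢-Q ∘ negV-injective) e
                 (trans (lookup-negV P e) (cong neg Pe)) (trans (lookup-negV Q e) (cong neg Qe))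
  ...   | Z , cZ , Ze , Z≼ = negV Z , C1 cZ , trans (lookup-negV Z e) (cong neg Ze) , ElimSigns-negV {P = P} {Q} {Z} Z≼

  eliminate-within-zeros : Cocircuit P → Cocircuit Q → lookup P x ≢ ⊙ → lookup Q x ≡ ⊙ →
    lookup P b ≢ ⊙ → lookup Q b ≢ ⊙ → VanishesOn P A → VanishesOn Q A →
    ∃ λ V → Cocircuit V × lookup V b ≡ ⊙ × VanishesOn V A
  eliminate-within-zeros {P = P} {Q = Q} {x = x} {b = b} cP cQ Px≢⊙ Qx≡⊙ Pb≢⊙ Qb≢⊙ P₀ Q₀
    with opposite-or-equal Qb≢⊙ Pb≢⊙
  ... | inj₁ Pb≡-Qb with eliminate cQ cP (≢negV-at x Qx≡⊙ Px≢⊙) Qb≢⊙ Pb≡-Qb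
  ...   | V , cV , Vb≡⊙ , V≼ = V , cV , Vb≡⊙ , ElimSigns-vanishes {P = Q} {P} {V} V≼ Q₀ P₀
  eliminate-within-zeros {P = P} {Q = Q} {x = x} {b = b} cP cQ Px≢⊙ Qx≡⊙ Pb≢⊙ Qb≢⊙ P₀ Q₀
    | inj₂ Pb≡Qb with eliminate cQ (C1 cP) (≢negV-at x Qx≡⊙ (lookup-negV-≢⊙ {P = P} x Px≢⊙)) Qb≢⊙
                      (trans (lookup-negV P b) (cong neg Pb≡Qb))
  ...   | V , cV , Vb≡⊙ , V≼ = V , cV , Vb≡⊙ , ElimSigns-vanishes {P = Q} {negV P} {V} V≼ Q₀ (VanishesOn-negV {P = P} P₀)

  Spanning-⊤ : Spanning O ⊤
  Spanning-⊤ X cX with nonzero-entry X (λ X≡0 → C0 (subst Cocircuit X≡0 cX))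
  ... | e , Xe≢⊙ = e , ∈⊤ , Xe≢⊙

  ¬¬-rank : ¬ ¬ ∃ (HasRank O ⊤)
  ¬¬-rank ¬rank = ¬¬-minimal (Spanning O) Spanning-⊤ λ { (B , isBasis) →
    ¬¬-maximum (λ m → ∃ λ I → Independent O I × ∣ I ∣ ≡ m) (B , (B , isBasis , λ b∈B → b∈B) , refl) n
      (λ { m (I , _ , refl) → ∣p∣≤n I })
      λ { (r , (I , indI , ∣I∣≡r) , maximal) →
        ¬rank (r , (I , (λ _ → ∈⊤) , indI , ∣I∣≡r) , λ J _ indJ → maximal _ (J , indJ , refl)) } }

  spanning-two-outside-zeros : Cocircuit P → Cocircuit Q → lookup P x ≢ ⊙ → lookup Q x ≡ ⊙ →
    VanishesOn P A → VanishesOn Q A → Spanning O B →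
    ∃₂ λ b₁ b₂ → b₁ ≢ b₂ × b₁ ∈ B × b₂ ∈ B × b₁ ∉ A × b₂ ∉ A
  spanning-two-outside-zeros {P = P} {Q = Q} {A = A} {B = B} cP cQ Px≢⊙ Qx≡⊙ P₀ Q₀ spanB with spanB P cP
  ... | b₁ , b₁∈B , Pb₁≢⊙ = second (lookup Q b₁ ≟⊙)
    where
    second-via : ∀ V → Cocircuit V → lookup V b₁ ≡ ⊙ → VanishesOn V A →
      ∃₂ λ b₁ b₂ → b₁ ≢ b₂ × b₁ ∈ B × b₂ ∈ B × b₁ ∉ A × b₂ ∉ A
    second-via V cV Vb₁≡⊙ V₀ with spanB V cV
    ... | b₂ , b₂∈B , Vb₂≢⊙ =
      b₁ , b₂ , (λ { refl → Vb₂≢⊙ Vb₁≡⊙ }) , b₁∈B , b₂∈B , Pb₁≢⊙ ∘ P₀ , Vb₂≢⊙ ∘ V₀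
    second : Dec (lookup Q b₁ ≡ ⊙) → ∃₂ λ b₁ b₂ → b₁ ≢ b₂ × b₁ ∈ B × b₂ ∈ B × b₁ ∉ A × b₂ ∉ A
    second (yes Qb₁≡⊙) = second-via Q cQ Qb₁≡⊙ Q₀
    second (no Qb₁≢⊙) with eliminate-within-zeros cP cQ Px≢⊙ Qx≡⊙ Pb₁≢⊙ Qb₁≢⊙ P₀ Q₀
    ... | V , cV , Vb₁≡⊙ , V₀ = second-via V cV Vb₁≡⊙ V₀

  rank-within-zeros : HasRank O ⊤ r → Cocircuit P → Cocircuit Q → lookup P x ≢ ⊙ → lookup Q x ≡ ⊙ →
    VanishesOn P A → VanishesOn Q A → J ⊆ A → Independent O J → ∣ J ∣ ≤ r ∸ 2
  rank-within-zeros rank cP cQ Px≢⊙ Qx≡⊙ P₀ Q₀ J⊆A (B , isBasis@(spanB , _) , J⊆B)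
    with spanning-two-outside-zeros cP cQ Px≢⊙ Qx≡⊙ P₀ Q₀ spanB
  ... | b₁ , b₂ , b₁≢b₂ , b₁∈B , b₂∈B , b₁∉A , b₂∉A =
    ∸-monoˡ-≤ 2 (≤-trans (two-more-elements J⊆B b₁≢b₂ b₁∈B b₂∈B (b₁∉A ∘ J⊆A) (b₂∉A ∘ J⊆A))
                         (proj₂ rank B (λ _ → ∈⊤) (B , isBasis , λ b∈B → b∈B)))

  -- By flatness rank(F ∪ {h}) > r - 2, whereas two cocircuits vanishing on it with different zero
  -- sets leave two elements of every basis outside it, forcing rank ≤ r - 2.
  corank-two-flat-extension-zeros : IsFlat O F → (∀ r → HasRank O ⊤ r → HasRank O F (r ∸ 2)) → h ∉ F →
    Cocircuit P → Cocircuit Q → VanishesOn P (F ∪ ⁅ h ⁆) → VanishesOn Q (F ∪ ⁅ h ⁆) →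
    lookup Q x ≡ ⊙ → lookup P x ≡ ⊙
  corank-two-flat-extension-zeros {F = F} {h = h} {P = P} {x = x} flat rankF h∉F cP cQ P₀ Q₀ Qx≡⊙
    with lookup P x ≟⊙
  ... | yes Px≡⊙ = Px≡⊙
  ... | no Px≢⊙ = ⊥-elim (¬¬-rank λ { (r , rank) →
          <-irrefl refl (flat h h∉F (r ∸ 2) (r ∸ 2) (rankF r rank) (rank-extension r rank)) })
    where
    rank-extension : ∀ r → HasRank O ⊤ r → HasRank O (F ∪ ⁅ h ⁆) (r ∸ 2)
    rank-extension r rank with rankF r rank
    ... | (I , I⊆F , indI , ∣I∣≡r∸2) , _ =
      (I , (λ i∈I → p⊆p∪q ⁅ h ⁆ (I⊆F i∈I)) , indI , ∣I∣≡r∸2) ,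
      λ J J⊆ indJ → rank-within-zeros rank cP cQ Px≢⊙ Qx≡⊙ P₀ Q₀ J⊆ indJ

  -- Eliminating b between Z and U keeps Z_a = 0 and U_a = -t, so W_a ∈ {0, -t}; and W_a = 0 would
  -- give two cocircuits on the hyperplane z(X ∘ Y) ∪ {a} that disagree at b.
  elimination-transfer : Comodular O X Y → lookup X a ≢ ⊙ → t ≢ ⊙ →
    Cocircuit U → ElimSigns (negV X) Y U → lookup U a ≡ neg t → lookup U b ≡ neg t →
    (∃ λ Z → IsElimination O a (negV X) Y Z × lookup Z b ≡ t) →
    ∃ λ W → IsElimination O b (negV X) Y W × lookup W a ≡ neg t
  elimination-transfer {X = X} {Y = Y} {a = a} {t = t} {U = U} {b = b} (_ , _ , flat , rankF) Xa≢⊙ t≢⊙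
                       cU U≼ Ua≡-t Ub≡-t (Z , (cZ , Za≡⊙ , Z≼) , Zb≡t)
    with eliminate cZ cU (≢negV-at {P = Z} {Q = U} a Za≡⊙ Ua≢⊙) (t≢⊙ ∘ trans (sym Zb≡t))
                   (trans Ub≡-t (cong neg (sym Zb≡t)))
    where
    Ua≢⊙ : lookup U a ≢ ⊙
    Ua≢⊙ Ua≡⊙ = t≢⊙ (neg-injective (trans (sym Ua≡-t) Ua≡⊙))
  ... | W , cW , Wb≡⊙ , ZU≼W = conclude (ElimSigns-⊙ˡ {P = Z} {U} {W} ZU≼W a Za≡⊙)
    where
    W≼ : ElimSigns (negV X) Y W
    W≼ = ElimSigns-trans {P = negV X} {Q = Y} {Z = Z} {U = U} {W = W} Z≼ U≼ ZU≼W
    conclude : lookup W a ≡ ⊙ ⊎ lookup W a ≡ lookup U a →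
      ∃ λ W → IsElimination O b (negV X) Y W × lookup W a ≡ neg t
    conclude (inj₂ Wa≡Ua) = W , (cW , Wb≡⊙ , W≼) , trans Wa≡Ua Ua≡-t
    conclude (inj₁ Wa≡⊙) = ⊥-elim (t≢⊙ (trans (sym Zb≡t)
      (corank-two-flat-extension-zeros flat rankF (Xa≢⊙ ∘ zset-∘ₛ-vanishesˡ {X = X} {Y}) cZ cW
        (vanishes-on-extension {X = X} {Y} {Z} Z≼ Za≡⊙) (vanishes-on-extension {X = X} {Y} {W} W≼ Wa≡⊙) Wb≡⊙)))

  conformal-side-with-sign : Cocircuit X → Cocircuit Y →
    lookup X a ≡ s → lookup Y a ≡ s → lookup X b ≡ s → lookup Y b ≡ s → s ≢ ⊙ → t ≢ ⊙ →
    ∃ λ U → Cocircuit U × ElimSigns (negV X) Y U × lookup U a ≡ t × lookup U b ≡ t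
  conformal-side-with-sign {X = X} {Y = Y} {a = a} {s = s} {b = b} {t = t} cX cY Xa≡s Ya≡s Xb≡s Yb≡s s≢⊙ t≢⊙
    with opposite-or-equal s≢⊙ t≢⊙
  ... | inj₁ t≡-s = negV X , C1 cX , ElimSigns-left {P = negV X} {Y} , -X≡t a Xa≡s , -X≡t b Xb≡s
    where
    -X≡t : ∀ i → lookup X i ≡ s → lookup (negV X) i ≡ t
    -X≡t i Xi≡s = trans (lookup-negV X i) (trans (cong neg Xi≡s) (sym t≡-s))
  ... | inj₂ t≡s = Y , cY , ElimSigns-right {P = negV X} {Y} , trans Ya≡s (sym t≡s) , trans Yb≡s (sym t≡s)

  elimination-reversal : Cocircuit X → Cocircuit Y → Comodular O X Y →
    lookup X a ≡ s → lookup Y a ≡ s → lookup X b ≡ s → lookup Y b ≡ s → s ≢ ⊙ → t ≢ ⊙ →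
    (∃ λ Z → IsElimination O a (negV X) Y Z × lookup Z b ≡ t) →
    ∃ λ W → IsElimination O b (negV X) Y W × lookup W a ≡ neg t
  elimination-reversal cX cY comodular Xa≡s Ya≡s Xb≡s Yb≡s s≢⊙ t≢⊙
    with conformal-side-with-sign cX cY Xa≡s Ya≡s Xb≡s Yb≡s s≢⊙ (t≢⊙ ∘ neg-injective)
  ... | U , cU , U≼ , Ua≡-t , Ub≡-t =
    elimination-transfer comodular (s≢⊙ ∘ trans (sym Xa≡s)) t≢⊙ cU U≼ Ua≡-t Ub≡-t

lemma2p10 : ∀ {n} (O : OrientedMatroid n) (g f : Fin n) →
    g ≢ f → ¬ IsLoop O g → ¬ IsColoop O f →
    (X Y : SignVec n) →
    OrientedMatroid.Cocircuit O X → OrientedMatroid.Cocircuit O Y →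
    Comodular O X Y →
    lookup X f ≡ lookup Y f → lookup Y f ≡ lookup X g →
    lookup X g ≡ lookup Y g → lookup Y g ≢ ⊙ →
    (Arrow O g f X Y to ⇔ Arrow O f g X Y from)
lemma2p10 O g f _ _ _ X Y cX cY comodular Xf≡Yf Yf≡Xg Xg≡Yg Yg≢⊙ =
  mk⇔ (λ { (_ , _ , _ , _ , _ , Z) →
             cX , cY , comodular , Xf≡Yf , Xf≢⊙ ,
             elimination-reversal O cX cY comodular Xg≡Yg refl Xf≡Yg Yf≡Yg Yg≢⊙ (λ ()) Z })
      (λ { (_ , _ , _ , _ , _ , W) →
             cX , cY , comodular , Xg≡Yg , Xg≢⊙ ,
             elimination-reversal O cX cY comodular Xf≡Yg Yf≡Yg Xg≡Yg refl Yg≢⊙ (λ ()) W })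
  where
  Yf≡Yg : lookup Y f ≡ lookup Y g
  Yf≡Yg = trans Yf≡Xg Xg≡Yg
  Xf≡Yg : lookup X f ≡ lookup Y g
  Xf≡Yg = trans Xf≡Yf Yf≡Yg
  Xg≢⊙ : lookup X g ≢ ⊙
  Xg≢⊙ = Yg≢⊙ ∘ trans (sym Xg≡Yg)
  Xf≢⊙ : lookup X f ≢ ⊙
  Xf≢⊙ = Yg≢⊙ ∘ trans (sym Xf≡Yg)
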